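{- We have $$\sum_{n=1}^{2^e}s(n)=\frac{3^e+1}{2}\ (e\geq 0),\qquad \sum_{n=1}^{2^e}(-1)^ns(n)=\frac{1-3^{e-1}}{2}\ (e\geq 1),$$ $$\sum_{n=1}^{2^e}t(n)=\frac{(-1)^e+1}{2}\ (e\geq 0),\qquad \sum_{n=1}^{2^e}(-1)^nt(n)=\frac{ -3+(-1)^e}{2}\ (e\geq 0).$$
   Context: The Stern sequence $s$ is defined by $s(0)=0$, $s(1)=1$, $s(2n)=s(n)$, $s(2n+1)=s(n)+s(n+1)$ for $n\geq1$. The twisted Stern sequence $t$ is defined by $t(0)=0$, $t(1)=1$, $t(2n)=-t(n)$, $t(2n+1)=-t(n)-t(n+1)$ for $n\geq 1$. -}

module Defs where

open import Data.Nat using (ℕ; zero; suc; _+_; _*_; _^_; _/_)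
open import Data.Nat.Base using (_%_)
open import Data.Integer as ℤ using (ℤ; +_; -_)
open import Data.List using (List; map; sum)
open import Data.Nat.ListAction using ()

-- Defined with a fuel argument (fuel k suffices for all n ≤ k) so that the
-- recursion on n / 2 is structural:
--   s 0 = 0, s 1 = 1, s (2n) = s n, s (2n+1) = s n + s (n+1)
--   t 0 = 0, t 1 = 1, t (2n) = - t n, t (2n+1) = - t n - t (n+1)
sF : ℕ → ℕ → ℤ
sF _ zero = + 0
sF _ (suc zero) = + 1
sF zero _ = + 0
sF (suc k) n@(suc (suc _)) with n % 2
... | zero = sF k (n / 2)
... | suc _ = sF k (n / 2) ℤ.+ sF k (suc (n / 2))

s : ℕ → ℤ
s n = sF n n

tF : ℕ → ℕ → ℤ
tF _ zero = + 0
tF _ (suc zero) = + 1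
tF zero _ = + 0
tF (suc k) n@(suc (suc _)) with n % 2
... | zero = - tF k (n / 2)
... | suc _ = - tF k (n / 2) ℤ.- tF k (suc (n / 2))

t : ℕ → ℤ
t n = tF n n

sgn : ℕ → ℤ
sgn zero = + 1
sgn (suc n) = - sgn n

sum1 : ℕ → (ℕ → ℤ) → ℤ
sum1 zero f = + 0
sum1 (suc N) f = sum1 N f ℤ.+ f (suc N)

-- Splitting a sum over 1..2N into even and odd indices and applying the
-- defining recurrences expresses it through S = Σ_{n ≤ N} s n, T = Σ_{n ≤ N} t n
-- and the value at N:  Σ_{n ≤ 2N} s = 3 S − s N,  Σ_{n ≤ 2N} (−1)ⁿ s = s N − S,
-- Σ_{n ≤ 2N} t = 2 − 3 T + t N  and  Σ_{n ≤ 2N} (−1)ⁿ t = T − t N − 2  (the last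
-- two need N ≥ 1, since t 1 escapes the odd recurrence).  At N = 2ᵉ we have
-- s N = 1 and t N = (−1)ᵉ, so each sum obeys a first-order linear recurrence in e.
module Submission where

open import Defs
open import Data.Nat as ℕ using (ℕ; zero; suc; _^_; NonZero; _≤_; _<_; z≤n; s≤s; _/_; _%_)
open import Data.Integer using (+_; -_; _+_; _-_; _*_)
open import Data.Product using (_×_; _,_)
open import Data.Nat.Properties using (≤-refl; ≤-trans; ≤-pred; n≤1+n; +-suc; m^n≢0)
open import Data.Nat.DivMod using (m/n<m; m/n≡1+[m∸n]/n)
open import Data.Integer.Properties using (neg-involutive; *-identityˡ; -1*i≡-i; pos-*)
open import Data.Integer.Tactic.RingSolver using (solve-∀)
open import Relation.Binary.PropositionalEquality using (_≡_; refl; sym; trans; cong; cong₂; module ≡-Reasoning)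

open ≡-Reasoning

double : ℕ → ℕ
double zero = zero
double (suc n) = suc (suc (double n))

double≡2* : ∀ n → double n ≡ 2 ℕ.* n
double≡2* zero = refl
double≡2* (suc n) = cong suc (trans (cong suc (double≡2* n)) (sym (+-suc n (n ℕ.+ 0))))

2^suc≡double : ∀ e → 2 ^ suc e ≡ double (2 ^ e)
2^suc≡double e = sym (double≡2* (2 ^ e))

n≤double : ∀ n → n ≤ double n
n≤double zero = z≤n
n≤double (suc n) = s≤s (≤-trans (n≤double n) (n≤1+n _))

double%2 : ∀ n → double n % 2 ≡ 0
double%2 zero = refl
double%2 (suc n) = double%2 n

suc-double%2 : ∀ n → suc (double n) % 2 ≡ 1
suc-double%2 zero = refl
suc-double%2 (suc n) = suc-double%2 n

[2+n]/2≡1+n/2 : ∀ n → suc (suc n) / 2 ≡ suc (n / 2)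
[2+n]/2≡1+n/2 n = m/n≡1+[m∸n]/n {suc (suc n)} (s≤s (s≤s z≤n))

double/2 : ∀ n → double n / 2 ≡ n
double/2 zero = refl
double/2 (suc n) = trans ([2+n]/2≡1+n/2 (double n)) (cong suc (double/2 n))

suc-double/2 : ∀ n → suc (double n) / 2 ≡ n
suc-double/2 zero = refl
suc-double/2 (suc n) = trans ([2+n]/2≡1+n/2 (suc (double n))) (cong suc (suc-double/2 n))

suc[n/2]<n : ∀ n → 3 ≤ n → suc (n / 2) < n
suc[n/2]<n (suc (suc zero)) (s≤s (s≤s ()))
suc[n/2]<n (suc (suc (suc m))) _ rewrite [2+n]/2≡1+n/2 (suc m) =
  s≤s (s≤s (m/n<m (suc m) 2 (s≤s (s≤s z≤n))))

halves-below-fuel : ∀ {n k} → 3 ≤ n → n ≤ suc k → suc (n / 2) ≤ k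
halves-below-fuel {n} 3≤n n≤1+k = ≤-pred (≤-trans (suc[n/2]<n n 3≤n) n≤1+k)

sF-fuel-irrelevant : ∀ {k k'} n → n ≤ k → n ≤ k' → sF k n ≡ sF k' n
sF-fuel-irrelevant zero _ _ = refl
sF-fuel-irrelevant (suc zero) _ _ = refl
sF-fuel-irrelevant {suc k} {suc k'} (suc (suc zero)) _ _ = refl
sF-fuel-irrelevant {suc k} {suc k'} n@(suc (suc (suc _))) n≤1+k n≤1+k' =
  by-parity (halves-below-fuel 3≤n n≤1+k) (halves-below-fuel 3≤n n≤1+k')
  where
  3≤n : 3 ≤ n
  3≤n = s≤s (s≤s (s≤s z≤n))
  by-parity : suc (n / 2) ≤ k → suc (n / 2) ≤ k' → sF (suc k) n ≡ sF (suc k') n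
  by-parity p q with n % 2
  ... | zero = sF-fuel-irrelevant (n / 2) (≤-trans (n≤1+n _) p) (≤-trans (n≤1+n _) q)
  ... | suc _ = cong₂ _+_ (sF-fuel-irrelevant (n / 2) (≤-trans (n≤1+n _) p) (≤-trans (n≤1+n _) q))
                          (sF-fuel-irrelevant (suc (n / 2)) p q)

tF-fuel-irrelevant : ∀ {k k'} n → n ≤ k → n ≤ k' → tF k n ≡ tF k' n
tF-fuel-irrelevant zero _ _ = refl
tF-fuel-irrelevant (suc zero) _ _ = refl
tF-fuel-irrelevant {suc k} {suc k'} (suc (suc zero)) _ _ = refl
tF-fuel-irrelevant {suc k} {suc k'} n@(suc (suc (suc _))) n≤1+k n≤1+k' =
  by-parity (halves-below-fuel 3≤n n≤1+k) (halves-below-fuel 3≤n n≤1+k')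
  where
  3≤n : 3 ≤ n
  3≤n = s≤s (s≤s (s≤s z≤n))
  by-parity : suc (n / 2) ≤ k → suc (n / 2) ≤ k' → tF (suc k) n ≡ tF (suc k') n
  by-parity p q with n % 2
  ... | zero = cong -_ (tF-fuel-irrelevant (n / 2) (≤-trans (n≤1+n _) p) (≤-trans (n≤1+n _) q))
  ... | suc _ = cong₂ _-_ (cong -_ (tF-fuel-irrelevant (n / 2) (≤-trans (n≤1+n _) p) (≤-trans (n≤1+n _) q)))
                          (tF-fuel-irrelevant (suc (n / 2)) p q)

sF-even-step : ∀ k m → suc (suc m) % 2 ≡ 0 → sF (suc k) (suc (suc m)) ≡ sF k (suc (suc m) / 2)
sF-even-step k m _ with suc (suc m) % 2
sF-even-step k m refl | zero = refl

sF-odd-step : ∀ k m → suc (suc m) % 2 ≡ 1 →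
              sF (suc k) (suc (suc m)) ≡ sF k (suc (suc m) / 2) + sF k (suc (suc (suc m) / 2))
sF-odd-step k m _ with suc (suc m) % 2
sF-odd-step k m refl | suc zero = refl

tF-even-step : ∀ k m → suc (suc m) % 2 ≡ 0 → tF (suc k) (suc (suc m)) ≡ - tF k (suc (suc m) / 2)
tF-even-step k m _ with suc (suc m) % 2
tF-even-step k m refl | zero = refl

tF-odd-step : ∀ k m → suc (suc m) % 2 ≡ 1 →
              tF (suc k) (suc (suc m)) ≡ - tF k (suc (suc m) / 2) - tF k (suc (suc (suc m) / 2))
tF-odd-step k m _ with suc (suc m) % 2
tF-odd-step k m refl | suc zero = refl

s-double : ∀ n → s (double n) ≡ s n
s-double zero = refl
s-double (suc n) = begin
  sF (suc k) (double (suc n))   ≡⟨ sF-even-step k (double n) (double%2 (suc n)) ⟩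
  sF k (double (suc n) / 2)     ≡⟨ cong (sF k) (double/2 (suc n)) ⟩
  sF k (suc n)                  ≡⟨ sF-fuel-irrelevant (suc n) (s≤s (n≤double n)) ≤-refl ⟩
  s (suc n)                     ∎
  where k = suc (double n)

s-suc-double : ∀ n → s (suc (double n)) ≡ s n + s (suc n)
s-suc-double zero = refl
s-suc-double (suc n) = begin
  sF (suc k) (suc (double (suc n)))
    ≡⟨ sF-odd-step k (suc (double n)) (suc-double%2 (suc n)) ⟩
  sF k (suc (double (suc n)) / 2) + sF k (suc (suc (double (suc n)) / 2))
    ≡⟨ cong (λ m → sF k m + sF k (suc m)) (suc-double/2 (suc n)) ⟩
  sF k (suc n) + sF k (suc (suc n))
    ≡⟨ cong₂ _+_ (sF-fuel-irrelevant (suc n) (s≤s (≤-trans (n≤double n) (n≤1+n _))) ≤-refl)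
                 (sF-fuel-irrelevant (suc (suc n)) (s≤s (s≤s (n≤double n))) ≤-refl) ⟩
  s (suc n) + s (suc (suc n))
    ∎
  where k = suc (suc (double n))

t-double : ∀ n → t (double n) ≡ - t n
t-double zero = refl
t-double (suc n) = begin
  tF (suc k) (double (suc n))   ≡⟨ tF-even-step k (double n) (double%2 (suc n)) ⟩
  - tF k (double (suc n) / 2)   ≡⟨ cong (λ m → - tF k m) (double/2 (suc n)) ⟩
  - tF k (suc n)                ≡⟨ cong -_ (tF-fuel-irrelevant (suc n) (s≤s (n≤double n)) ≤-refl) ⟩
  - t (suc n)                   ∎
  where k = suc (double n)

t-suc-double : ∀ n .{{_ : NonZero n}} → t (suc (double n)) ≡ - t n - t (suc n)
t-suc-double (suc n) = begin
  tF (suc k) (suc (double (suc n)))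
    ≡⟨ tF-odd-step k (suc (double n)) (suc-double%2 (suc n)) ⟩
  - tF k (suc (double (suc n)) / 2) - tF k (suc (suc (double (suc n)) / 2))
    ≡⟨ cong (λ m → - tF k m - tF k (suc m)) (suc-double/2 (suc n)) ⟩
  - tF k (suc n) - tF k (suc (suc n))
    ≡⟨ cong₂ _-_ (cong -_ (tF-fuel-irrelevant (suc n) (s≤s (≤-trans (n≤double n) (n≤1+n _))) ≤-refl))
                 (tF-fuel-irrelevant (suc (suc n)) (s≤s (s≤s (n≤double n))) ≤-refl) ⟩
  - t (suc n) - t (suc (suc n))
    ∎
  where k = suc (suc (double n))

sgn-double : ∀ n → sgn (double n) ≡ + 1
sgn-double zero = refl
sgn-double (suc n) = trans (neg-involutive (sgn (double n))) (sgn-double n)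

sgn-double-* : ∀ n x → sgn (double n) * x ≡ x
sgn-double-* n x = trans (cong (_* x) (sgn-double n)) (*-identityˡ x)

sgn-suc-double-* : ∀ n x → sgn (suc (double n)) * x ≡ - x
sgn-suc-double-* n x = trans (cong (λ u → - u * x) (sgn-double n)) (-1*i≡-i x)

sum-s-double : ∀ n → sum1 (double n) s ≡ + 3 * sum1 n s - s n
sum-s-double zero = refl
sum-s-double (suc n) = begin
  sum1 (double n) s + s (suc (double n)) + s (double (suc n))
    ≡⟨ cong₂ _+_ (cong₂ _+_ (sum-s-double n) (s-suc-double n)) (s-double (suc n)) ⟩
  (+ 3 * S - s n) + (s n + s (suc n)) + s (suc n)
    ≡⟨ regroup S (s n) (s (suc n)) ⟩
  + 3 * (S + s (suc n)) - s (suc n)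
    ∎
  where
  S = sum1 n s
  regroup : ∀ a x y → (+ 3 * a - x) + (x + y) + y ≡ + 3 * (a + y) - y
  regroup = solve-∀

alternating-sum-s-double : ∀ n → sum1 (double n) (λ m → sgn m * s m) ≡ s n - sum1 n s
alternating-sum-s-double zero = refl
alternating-sum-s-double (suc n) = begin
  sum1 (double n) f + sgn (suc (double n)) * s (suc (double n)) + sgn (double (suc n)) * s (double (suc n))
    ≡⟨ cong₂ _+_ (cong₂ _+_ (alternating-sum-s-double n)
                            (trans (sgn-suc-double-* n _) (cong -_ (s-suc-double n))))
                 (trans (sgn-double-* (suc n) _) (s-double (suc n))) ⟩
  (s n - S) + - (s n + s (suc n)) + s (suc n)
    ≡⟨ regroup S (s n) (s (suc n)) ⟩
  s (suc n) - (S + s (suc n))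
    ∎
  where
  f = λ m → sgn m * s m
  S = sum1 n s
  regroup : ∀ a x y → (x - a) + - (x + y) + y ≡ y - (a + y)
  regroup = solve-∀

sum-t-double : ∀ n .{{_ : NonZero n}} → sum1 (double n) t ≡ + 2 - + 3 * sum1 n t + t n
sum-t-double (suc zero) = refl
sum-t-double (suc (suc n)) = begin
  sum1 (double (suc n)) t + t (suc (double (suc n))) + t (double (suc (suc n)))
    ≡⟨ cong₂ _+_ (cong₂ _+_ (sum-t-double (suc n)) (t-suc-double (suc n))) (t-double (suc (suc n))) ⟩
  (+ 2 - + 3 * T + t (suc n)) + (- t (suc n) - t (suc (suc n))) + - t (suc (suc n))
    ≡⟨ regroup T (t (suc n)) (t (suc (suc n))) ⟩
  + 2 - + 3 * (T + t (suc (suc n))) + t (suc (suc n))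
    ∎
  where
  T = sum1 (suc n) t
  regroup : ∀ a x y → (+ 2 - + 3 * a + x) + (- x - y) + - y ≡ + 2 - + 3 * (a + y) + y
  regroup = solve-∀

alternating-sum-t-double : ∀ n .{{_ : NonZero n}} →
                           sum1 (double n) (λ m → sgn m * t m) ≡ sum1 n t - t n - + 2
alternating-sum-t-double (suc zero) = refl
alternating-sum-t-double (suc (suc n)) = begin
  sum1 (double (suc n)) f + sgn (suc (double (suc n))) * t (suc (double (suc n)))
                          + sgn (double (suc (suc n))) * t (double (suc (suc n)))
    ≡⟨ cong₂ _+_ (cong₂ _+_ (alternating-sum-t-double (suc n))
                            (trans (sgn-suc-double-* (suc n) _) (cong -_ (t-suc-double (suc n)))))
                 (trans (sgn-double-* (suc (suc n)) _) (t-double (suc (suc n)))) ⟩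
  (T - t (suc n) - + 2) + - (- t (suc n) - t (suc (suc n))) + - t (suc (suc n))
    ≡⟨ regroup T (t (suc n)) (t (suc (suc n))) ⟩
  (T + t (suc (suc n))) - t (suc (suc n)) - + 2
    ∎
  where
  f = λ m → sgn m * t m
  T = sum1 (suc n) t
  regroup : ∀ a x y → (a - x - + 2) + - (- x - y) + - y ≡ (a + y) - y - + 2
  regroup = solve-∀

s-2^ : ∀ e → s (2 ^ e) ≡ + 1
s-2^ zero = refl
s-2^ (suc e) = trans (cong s (2^suc≡double e)) (trans (s-double (2 ^ e)) (s-2^ e))

t-2^ : ∀ e → t (2 ^ e) ≡ sgn e
t-2^ zero = refl
t-2^ (suc e) = trans (cong t (2^suc≡double e)) (trans (t-double (2 ^ e)) (cong -_ (t-2^ e)))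

sum-s-2^ : ∀ e → + 2 * sum1 (2 ^ e) s ≡ + (3 ^ e) + + 1
sum-s-2^ zero = refl
sum-s-2^ (suc e) = begin
  + 2 * sum1 (2 ^ suc e) s        ≡⟨ cong (λ N → + 2 * sum1 N s) (2^suc≡double e) ⟩
  + 2 * sum1 (double (2 ^ e)) s   ≡⟨ cong (+ 2 *_) (sum-s-double (2 ^ e)) ⟩
  + 2 * (+ 3 * S - s (2 ^ e))     ≡⟨ cong (λ x → + 2 * (+ 3 * S - x)) (s-2^ e) ⟩
  + 2 * (+ 3 * S - + 1)           ≡⟨ regroup S ⟩
  + 3 * (+ 2 * S) - + 2           ≡⟨ cong (λ x → + 3 * x - + 2) (sum-s-2^ e) ⟩
  + 3 * (+ (3 ^ e) + + 1) - + 2   ≡⟨ simplify (+ (3 ^ e)) ⟩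
  + 3 * + (3 ^ e) + + 1           ≡⟨ cong (_+ + 1) (sym (pos-* 3 (3 ^ e))) ⟩
  + (3 ^ suc e) + + 1             ∎
  where
  S = sum1 (2 ^ e) s
  regroup : ∀ a → + 2 * (+ 3 * a - + 1) ≡ + 3 * (+ 2 * a) - + 2
  regroup = solve-∀
  simplify : ∀ x → + 3 * (x + + 1) - + 2 ≡ + 3 * x + + 1
  simplify = solve-∀

alternating-sum-s-2^ : ∀ e → + 2 * sum1 (2 ^ suc e) (λ n → sgn n * s n) ≡ + 1 - + (3 ^ e)
alternating-sum-s-2^ e = begin
  + 2 * sum1 (2 ^ suc e) f        ≡⟨ cong (λ N → + 2 * sum1 N f) (2^suc≡double e) ⟩
  + 2 * sum1 (double (2 ^ e)) f   ≡⟨ cong (+ 2 *_) (alternating-sum-s-double (2 ^ e)) ⟩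
  + 2 * (s (2 ^ e) - S)           ≡⟨ cong (λ x → + 2 * (x - S)) (s-2^ e) ⟩
  + 2 * (+ 1 - S)                 ≡⟨ regroup S ⟩
  + 2 - + 2 * S                   ≡⟨ cong (λ x → + 2 - x) (sum-s-2^ e) ⟩
  + 2 - (+ (3 ^ e) + + 1)         ≡⟨ simplify (+ (3 ^ e)) ⟩
  + 1 - + (3 ^ e)                 ∎
  where
  f = λ n → sgn n * s n
  S = sum1 (2 ^ e) s
  regroup : ∀ a → + 2 * (+ 1 - a) ≡ + 2 - + 2 * a
  regroup = solve-∀
  simplify : ∀ x → + 2 - (x + + 1) ≡ + 1 - x
  simplify = solve-∀

sum-t-2^ : ∀ e → + 2 * sum1 (2 ^ e) t ≡ sgn e + + 1
sum-t-2^ zero = refl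
sum-t-2^ (suc e) = begin
  + 2 * sum1 (2 ^ suc e) t               ≡⟨ cong (λ N → + 2 * sum1 N t) (2^suc≡double e) ⟩
  + 2 * sum1 (double (2 ^ e)) t          ≡⟨ cong (+ 2 *_) (sum-t-double (2 ^ e) {{m^n≢0 2 e}}) ⟩
  + 2 * (+ 2 - + 3 * T + t (2 ^ e))      ≡⟨ cong (λ x → + 2 * (+ 2 - + 3 * T + x)) (t-2^ e) ⟩
  + 2 * (+ 2 - + 3 * T + sgn e)          ≡⟨ regroup T (sgn e) ⟩
  + 4 - + 3 * (+ 2 * T) + + 2 * sgn e    ≡⟨ cong (λ x → + 4 - + 3 * x + + 2 * sgn e) (sum-t-2^ e) ⟩
  + 4 - + 3 * (sgn e + + 1) + + 2 * sgn e ≡⟨ simplify (sgn e) ⟩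
  - sgn e + + 1                          ∎
  where
  T = sum1 (2 ^ e) t
  regroup : ∀ a u → + 2 * (+ 2 - + 3 * a + u) ≡ + 4 - + 3 * (+ 2 * a) + + 2 * u
  regroup = solve-∀
  simplify : ∀ u → + 4 - + 3 * (u + + 1) + + 2 * u ≡ - u + + 1
  simplify = solve-∀

alternating-sum-t-2^ : ∀ e → + 2 * sum1 (2 ^ e) (λ n → sgn n * t n) ≡ - + 3 + sgn e
alternating-sum-t-2^ zero = refl
alternating-sum-t-2^ (suc e) = begin
  + 2 * sum1 (2 ^ suc e) f          ≡⟨ cong (λ N → + 2 * sum1 N f) (2^suc≡double e) ⟩
  + 2 * sum1 (double (2 ^ e)) f     ≡⟨ cong (+ 2 *_) (alternating-sum-t-double (2 ^ e) {{m^n≢0 2 e}}) ⟩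
  + 2 * (T - t (2 ^ e) - + 2)       ≡⟨ cong (λ x → + 2 * (T - x - + 2)) (t-2^ e) ⟩
  + 2 * (T - sgn e - + 2)           ≡⟨ regroup T (sgn e) ⟩
  + 2 * T - + 2 * sgn e - + 4       ≡⟨ cong (λ x → x - + 2 * sgn e - + 4) (sum-t-2^ e) ⟩
  sgn e + + 1 - + 2 * sgn e - + 4   ≡⟨ simplify (sgn e) ⟩
  - + 3 + - sgn e                   ∎
  where
  f = λ n → sgn n * t n
  T = sum1 (2 ^ e) t
  regroup : ∀ a u → + 2 * (a - u - + 2) ≡ + 2 * a - + 2 * u - + 4
  regroup = solve-∀
  simplify : ∀ u → u + + 1 - + 2 * u - + 4 ≡ - + 3 + - u
  simplify = solve-∀

mainTheorem12 :
      (∀ (e : ℕ) → + 2 * sum1 (2 ^ e) s ≡ + (3 ^ e) + + 1)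
    × (∀ (e : ℕ) → + 2 * sum1 (2 ^ suc e) (λ n → sgn n * s n) ≡ + 1 - + (3 ^ e))
    × (∀ (e : ℕ) → + 2 * sum1 (2 ^ e) t ≡ sgn e + + 1)
    × (∀ (e : ℕ) → + 2 * sum1 (2 ^ e) (λ n → sgn n * t n) ≡ - + 3 + sgn e)
mainTheorem12 = sum-s-2^ , alternating-sum-s-2^ , sum-t-2^ , alternating-sum-t-2^
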